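{- Let $q$ be a power of $2$ with $q \ge 8$. Then in $PG(2,q)$ there exists an untouchable set of size $2q+1$.
   Context: $PG(2,q)$ is the Desarguesian projective plane over the finite field $GF(q)$. An untouchable set in a projective plane is a set of points such that no line of the plane meets the set in exactly one point. -}

module Defs where

open import Level using (Level; _⊔_)
open import Data.Nat using (ℕ)
open import Data.Fin using (Fin)
open import Data.Product using (Σ; ∃; _×_; _,_)
open import Data.List using (List; length)
open import Data.List.Relation.Unary.AllPairs using (AllPairs)
open import Data.List.Membership.Propositional using (_∈_)
open import Relation.Nullary using (¬_)
open import Relation.Binary.PropositionalEquality using (_≡_)
open import Algebra.Bundles using (CommutativeRing)

record IsFieldCR {c ℓ : Level} (R : CommutativeRing c ℓ) : Set (c ⊔ ℓ) where
  open CommutativeRing R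
  field
    0≉1     : ¬ (0# ≈ 1#)
    inverse : ∀ x → ¬ (x ≈ 0#) → ∃ λ y → x * y ≈ 1#

record HasOrder {c ℓ : Level} (R : CommutativeRing c ℓ) (q : ℕ) : Set (c ⊔ ℓ) where
  open CommutativeRing R
  field
    enum       : Fin q → Carrier
    enum-inj   : ∀ i j → enum i ≈ enum j → i ≡ j
    enum-surj  : ∀ x → ∃ λ i → enum i ≈ x

module ProjectivePlane {c ℓ : Level} (R : CommutativeRing c ℓ) where
  open CommutativeRing R

  Triple : Set c
  Triple = Carrier × Carrier × Carrier

  Nonzero : Triple → Set ℓ
  Nonzero (x , y , z) = ¬ ((x ≈ 0#) × (y ≈ 0#) × (z ≈ 0#))

  -- u and v represent the same projective point (or line)
  Proportional : Triple → Triple → Set (c ⊔ ℓ)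
  Proportional (x , y , z) (x' , y' , z') =
    ∃ λ t → ¬ (t ≈ 0#) × (x ≈ t * x') × (y ≈ t * y') × (z ≈ t * z')

  Incident : Triple → Triple → Set ℓ
  Incident (x , y , z) (a , b , c') = a * x + b * y + c' * z ≈ 0#

  record PointSet : Set (c ⊔ ℓ) where
    field
      pts      : List Triple
      nonzero  : ∀ {p} → p ∈ pts → Nonzero p
      distinct : AllPairs (λ u v → ¬ Proportional u v) pts

  open PointSet public

  size : PointSet → ℕ
  size S = length (pts S)

  -- Untouchable: no line meets S in exactly one point, i.e. whenever a line
  -- contains a point P of S it contains a further point P' of S, P' ≠ P.
  Untouchable : PointSet → Set (c ⊔ ℓ)
  Untouchable S =
    ∀ (L : Triple) → Nonzero L →
    ∀ {P} → P ∈ pts S → Incident P L →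
    ∃ λ P' → (P' ∈ pts S) × Incident P' L × ¬ Proportional P P'

{-# OPTIONS --safe #-}
-- In characteristic 2 the two conics x² = yz and αx² = yz (α ≠ 0, 1) have
-- the same nucleus N = (1:0:0), on which all their tangents meet, and they
-- share the points (0:1:0) and (0:0:1). Their union together with N has
-- 2q + 1 points. A line through a point of one conic either passes through
-- N, or meets that conic again: the other root of a t² + b t + c with b ≠ 0
-- is t + b/a. A line through N misses neither conic, because squaring is
-- a bijection of a finite field of characteristic 2.
module Submission where

open import Defs
open import Level using (Level; _⊔_)
open import Data.Nat as ℕ using (ℕ; zero; suc; _≤_; s≤s; z≤n)
import Data.Nat.Properties as ℕP
open import Data.Fin as Fin using (Fin; punchOut)
open import Data.Fin.Properties using (any?; injective⇒≤; punchOut-injective)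
open import Data.Fin.Permutation using (Permutation; permutation)
open import Data.Product as Σ using (Σ; ∃; _×_; _,_; proj₁; proj₂)
open import Data.Sum using (inj₁; inj₂)
open import Data.List using (List; []; _∷_; [_]; _++_; tabulate; length)
open import Data.List.Properties using (length-++; length-tabulate)
open import Data.List.Membership.Propositional using (_∈_)
open import Data.List.Membership.Propositional.Properties
  using (∈-++⁻; ∈-++⁺ˡ; ∈-++⁺ʳ; ∈-tabulate⁻; ∈-tabulate⁺)
open import Data.List.Relation.Unary.Any using (here)
open import Data.List.Relation.Unary.All using (All; []; _∷_)
import Data.List.Relation.Unary.All.Properties as All
open import Data.List.Relation.Unary.AllPairs using (AllPairs; []; _∷_)
import Data.List.Relation.Unary.AllPairs.Properties as AllPairs
open import Algebra.Bundles using (CommutativeRing)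
import Algebra.Properties.AbelianGroup
import Algebra.Properties.CommutativeSemigroup
import Algebra.Properties.CommutativeMonoid.Sum
import Algebra.Properties.Semiring.Mult
import Algebra.Solver.Ring.NaturalCoefficients.Default
open import Function.Definitions using (Injective)
open import Relation.Binary.Definitions using (Decidable)
open import Relation.Binary.PropositionalEquality as ≡ using (_≡_; _≢_)
open import Relation.Nullary using (¬_; yes; no; contradiction)
open import Relation.Nullary.Decidable using (map′; decidable-stable)

∃-avoiding-two : ∀ {n} → 3 ≤ n → (a b : Fin n) → ∃ λ i → i ≢ a × i ≢ b
∃-avoiding-two (s≤s (s≤s (s≤s _))) Fin.zero Fin.zero =
  Fin.suc Fin.zero , (λ ()) , (λ ())
∃-avoiding-two (s≤s (s≤s (s≤s _))) Fin.zero (Fin.suc Fin.zero) =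
  Fin.suc (Fin.suc Fin.zero) , (λ ()) , (λ ())
∃-avoiding-two (s≤s (s≤s (s≤s _))) Fin.zero (Fin.suc (Fin.suc _)) =
  Fin.suc Fin.zero , (λ ()) , (λ ())
∃-avoiding-two (s≤s (s≤s (s≤s _))) (Fin.suc Fin.zero) Fin.zero =
  Fin.suc (Fin.suc Fin.zero) , (λ ()) , (λ ())
∃-avoiding-two (s≤s (s≤s (s≤s _))) (Fin.suc (Fin.suc _)) Fin.zero =
  Fin.suc Fin.zero , (λ ()) , (λ ())
∃-avoiding-two (s≤s (s≤s (s≤s _))) (Fin.suc _) (Fin.suc _) =
  Fin.zero , (λ ()) , (λ ())

Fin-injective⇒surjective : ∀ {n} {f : Fin n → Fin n} → Injective _≡_ _≡_ f →
                           ∀ y → ∃ λ x → f x ≡ y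
Fin-injective⇒surjective {suc n} {f} f-inj y with any? (λ x → f x Fin.≟ y)
... | yes hit  = hit
... | no  miss = contradiction (injective⇒≤ f′-inj) ℕP.1+n≰n
  where
  y≢f : ∀ x → y ≢ f x
  y≢f x y≡fx = miss (x , ≡.sym y≡fx)

  f′ : Fin (suc n) → Fin n
  f′ x = punchOut (y≢f x)

  f′-inj : Injective _≡_ _≡_ f′
  f′-inj {x} {x′} eq = f-inj (punchOut-injective (y≢f x) (y≢f x′) eq)

length-tabulate-++-tabulate-++-[_] : ∀ {a} {A : Set a} {n} x (f g : Fin n → A) →
                                      length (tabulate f ++ tabulate g ++ [ x ]) ≡ 2 ℕ.* n ℕ.+ 1
length-tabulate-++-tabulate-++-[_] {n = n} x f g = begin
  length (tabulate f ++ tabulate g ++ [ x ])             ≡⟨ length-++ (tabulate f) ⟩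
  length (tabulate f) ℕ.+ length (tabulate g ++ [ x ])   ≡⟨ ≡.cong (length (tabulate f) ℕ.+_) (length-++ (tabulate g)) ⟩
  length (tabulate f) ℕ.+ (length (tabulate g) ℕ.+ 1)
    ≡⟨ ≡.cong₂ (λ l m → l ℕ.+ (m ℕ.+ 1)) (length-tabulate f) (length-tabulate g) ⟩
  n ℕ.+ (n ℕ.+ 1)                                        ≡⟨ ℕP.+-assoc n n 1 ⟨
  n ℕ.+ n ℕ.+ 1                                          ≡⟨ ≡.cong (λ m → n ℕ.+ m ℕ.+ 1) (ℕP.+-identityʳ n) ⟨
  2 ℕ.* n ℕ.+ 1                                          ∎
  where open ≡.≡-Reasoning

module Enumeration {c ℓ : Level} (R : CommutativeRing c ℓ) {q : ℕ} (ord : HasOrder R q) where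
  open CommutativeRing R
  open HasOrder ord
  open import Relation.Binary.Reasoning.Setoid setoid
  open Algebra.Properties.AbelianGroup +-abelianGroup
    using (//-rightDividesˡ; //-rightDividesʳ; identityʳ-unique)
  open Algebra.Properties.CommutativeMonoid.Sum +-commutativeMonoid
    using (sum; sum-permute; sum-cong-≋; ∑-distrib-+; sum-replicate)
  open Algebra.Properties.Semiring.Mult semiring using () renaming (_×_ to _·_)

  index : Carrier → Fin q
  index x = proj₁ (enum-surj x)

  enum-index : ∀ x → enum (index x) ≈ x
  enum-index x = proj₂ (enum-surj x)

  index≡⇒≈ : ∀ {x y} → index x ≡ index y → x ≈ y
  index≡⇒≈ {x} {y} eq = trans (sym (enum-index x)) (trans (reflexive (≡.cong enum eq)) (enum-index y))

  enum≈⇒≡ : ∀ {i} {x} → enum i ≈ x → i ≡ index x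
  enum≈⇒≡ {i} {x} e = enum-inj _ _ (trans e (sym (enum-index x)))

  _≟_ : Decidable _≈_
  x ≟ y = map′ index≡⇒≈ (λ x≈y → enum≈⇒≡ (trans (enum-index x) x≈y)) (index x Fin.≟ index y)

  injective⇒surjective : (f : Carrier → Carrier) → (∀ {x y} → f x ≈ f y → x ≈ y) →
                         ∀ y → ∃ λ x → f x ≈ y
  injective⇒surjective f f-inj y =
    Σ.map enum index≡⇒≈ (Fin-injective⇒surjective {f = f̂} f̂-inj (index y))
    where
    f̂ : Fin q → Fin q
    f̂ i = index (f (enum i))

    f̂-inj : Injective _≡_ _≡_ f̂
    f̂-inj eq = enum-inj _ _ (f-inj (index≡⇒≈ eq))

  ∃≉0,1 : 3 ≤ q → ∃ λ α → α ≉ 0# × α ≉ 1#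
  ∃≉0,1 3≤q with i , i≢0 , i≢1 ← ∃-avoiding-two 3≤q (index 0#) (index 1#)
    = enum i , (λ i≈0 → i≢0 (enum≈⇒≡ i≈0)) , (λ i≈1 → i≢1 (enum≈⇒≡ i≈1))

  -- Translation by 1 permutes the elements, so it fixes their sum.
  order·1≈0 : q · 1# ≈ 0#
  order·1≈0 = identityʳ-unique (sum enum) (q · 1#) (sym (begin
    sum enum                        ≈⟨ sum-permute enum +1 ⟩
    sum (λ i → enum (index (enum i + 1#)))
      ≈⟨ sum-cong-≋ {q} (λ i → enum-index (enum i + 1#)) ⟩
    sum (λ i → enum i + 1#)         ≈⟨ ∑-distrib-+ {q} enum (λ _ → 1#) ⟩
    sum enum + sum {q} (λ _ → 1#)   ≈⟨ +-congˡ (sum-replicate q) ⟩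
    sum enum + q · 1#               ∎))
    where
    +1 : Permutation q q
    +1 = permutation (λ i → index (enum i + 1#)) (λ i → index (enum i - 1#))
      (λ i → enum-inj _ _ (trans (enum-index _)
               (trans (+-congʳ (enum-index _)) (//-rightDividesˡ 1# (enum i)))))
      (λ i → enum-inj _ _ (trans (enum-index _)
               (trans (+-congʳ (enum-index _)) (//-rightDividesʳ 1# (enum i)))))

module FieldProperties {c ℓ : Level} (F : CommutativeRing c ℓ) (fld : IsFieldCR F) where
  open CommutativeRing F
  open IsFieldCR fld
  open import Relation.Binary.Reasoning.Setoid setoid
  open Algebra.Properties.Semiring.Mult semiring using (×-homo-1; ×1-homo-*) renaming (_×_ to _·_)
  open Algebra.Properties.CommutativeSemigroup *-commutativeSemigroup using (x∙yz≈y∙xz)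

  1≉0 : 1# ≉ 0#
  1≉0 1≈0 = 0≉1 (sym 1≈0)

  x≈0⇒x*y≈0 : ∀ {x y} → x ≈ 0# → x * y ≈ 0#
  x≈0⇒x*y≈0 {x} {y} x≈0 = trans (*-congʳ x≈0) (zeroˡ y)

  y≈0⇒x*y≈0 : ∀ {x y} → y ≈ 0# → x * y ≈ 0#
  y≈0⇒x*y≈0 {x} {y} y≈0 = trans (*-congˡ y≈0) (zeroʳ x)

  x+y+z≈0 : ∀ {x y z} → x ≈ 0# → y ≈ 0# → z ≈ 0# → x + y + z ≈ 0#
  x+y+z≈0 x≈0 y≈0 z≈0 =
    trans (+-cong (+-cong x≈0 y≈0) z≈0) (trans (+-identityʳ _) (+-identityʳ 0#))

  *-cancelˡ : ∀ {l x y} → l ≉ 0# → l * x ≈ l * y → x ≈ y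
  *-cancelˡ {l} {x} {y} l≉0 lx≈ly with inverse l l≉0
  ... | l⁻¹ , ll⁻¹≈1 = begin
    x               ≈⟨ *-identityˡ x ⟨
    1# * x          ≈⟨ *-congʳ l⁻¹l≈1 ⟨
    (l⁻¹ * l) * x   ≈⟨ *-assoc l⁻¹ l x ⟩
    l⁻¹ * (l * x)   ≈⟨ *-congˡ lx≈ly ⟩
    l⁻¹ * (l * y)   ≈⟨ *-assoc l⁻¹ l y ⟨
    (l⁻¹ * l) * y   ≈⟨ *-congʳ l⁻¹l≈1 ⟩
    1# * y          ≈⟨ *-identityˡ y ⟩
    y               ∎
    where l⁻¹l≈1 = trans (*-comm l⁻¹ l) ll⁻¹≈1

  x*y≈0⇒y≈0 : ∀ {x y} → x ≉ 0# → x * y ≈ 0# → y ≈ 0#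
  x*y≈0⇒y≈0 {x} x≉0 xy≈0 = *-cancelˡ x≉0 (trans xy≈0 (sym (zeroʳ x)))

  x≈l*x⇒l≈1 : ∀ {x l} → x ≉ 0# → x ≈ l * x → l ≈ 1#
  x≈l*x⇒l≈1 {x} {l} x≉0 x≈lx =
    *-cancelˡ x≉0 (trans (*-comm x l) (trans (sym x≈lx) (sym (*-identityʳ x))))

  x*[y*x⁻¹]≈y : ∀ {x x⁻¹} → x * x⁻¹ ≈ 1# → ∀ y → x * (y * x⁻¹) ≈ y
  x*[y*x⁻¹]≈y {x} {x⁻¹} xx⁻¹≈1 y = begin
    x * (y * x⁻¹)   ≈⟨ x∙yz≈y∙xz x y x⁻¹ ⟩
    y * (x * x⁻¹)   ≈⟨ *-congˡ xx⁻¹≈1 ⟩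
    y * 1#          ≈⟨ *-identityʳ y ⟩
    y               ∎

  2^k·1≉0 : 1# + 1# ≉ 0# → ∀ k → (2 ℕ.^ k) · 1# ≉ 0#
  2^k·1≉0 _   zero    1·1≈0 = 1≉0 (trans (sym (×-homo-1 1#)) 1·1≈0)
  2^k·1≉0 2≉0 (suc k) 2^[1+k]·1≈0 = 2^k·1≉0 2≉0 k (x*y≈0⇒y≈0 2≉0 (begin
    (1# + 1#) * ((2 ℕ.^ k) · 1#)   ≈⟨ *-congʳ (+-congˡ (+-identityʳ 1#)) ⟨
    (2 · 1#) * ((2 ℕ.^ k) · 1#)    ≈⟨ ×1-homo-* 2 (2 ℕ.^ k) ⟨
    (2 ℕ.^ suc k) · 1#             ≈⟨ 2^[1+k]·1≈0 ⟩
    0#                             ∎))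

  order-2^k⇒1+1≈0 : ∀ k → HasOrder F (2 ℕ.^ k) → 1# + 1# ≈ 0#
  order-2^k⇒1+1≈0 k ord = decidable-stable ((1# + 1#) ≟ 0#) (λ 2≉0 → 2^k·1≉0 2≉0 k order·1≈0)
    where open Enumeration F ord using (_≟_; order·1≈0)

  module Characteristic2 (_≟_ : Decidable _≈_) (1+1≈0 : 1# + 1# ≈ 0#) where
    open Algebra.Properties.AbelianGroup +-abelianGroup using (identityʳ-unique)
    open Algebra.Solver.Ring.NaturalCoefficients.Default commutativeSemiring

    x+x≈0 : ∀ x → x + x ≈ 0#
    x+x≈0 x = begin
      x + x               ≈⟨ +-cong (*-identityˡ x) (*-identityˡ x) ⟨
      1# * x + 1# * x     ≈⟨ distribʳ x 1# 1# ⟨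
      (1# + 1#) * x       ≈⟨ *-congʳ 1+1≈0 ⟩
      0# * x              ≈⟨ zeroˡ x ⟩
      0#                  ∎

    x+y≈0⇒x≈y : ∀ {x y} → x + y ≈ 0# → x ≈ y
    x+y≈0⇒x≈y {x} {y} x+y≈0 = begin
      x                 ≈⟨ +-identityʳ x ⟨
      x + 0#            ≈⟨ +-congˡ (x+x≈0 y) ⟨
      x + (y + y)       ≈⟨ +-assoc x y y ⟨
      (x + y) + y       ≈⟨ +-congʳ x+y≈0 ⟩
      0# + y            ≈⟨ +-identityˡ y ⟩
      y                 ∎

    square-+ : ∀ x y → (x + y) * (x + y) ≈ x * x + y * y
    square-+ x y = begin
      (x + y) * (x + y)
        ≈⟨ solve 2 (λ x y → (x :+ y) :* (x :+ y) := (x :* x :+ y :* y) :+ (x :* y :+ x :* y)) refl x y ⟩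
      (x * x + y * y) + (x * y + x * y)   ≈⟨ +-congˡ (x+x≈0 (x * y)) ⟩
      (x * x + y * y) + 0#                ≈⟨ +-identityʳ _ ⟩
      x * x + y * y                       ∎

    square-injective : ∀ {x y} → x * x ≈ y * y → x ≈ y
    square-injective {x} {y} x²≈y² with (x + y) ≟ 0#
    ... | yes x+y≈0 = x+y≈0⇒x≈y x+y≈0
    ... | no  x+y≉0 = contradiction (x*y≈0⇒y≈0 x+y≉0 (begin
      (x + y) * (x + y)   ≈⟨ square-+ x y ⟩
      x * x + y * y       ≈⟨ +-congʳ x²≈y² ⟩
      y * y + y * y       ≈⟨ x+x≈0 (y * y) ⟩
      0#                  ∎)) x+y≉0

    -- The roots of b t² + a t + c sum to a / b.
    second-root : ∀ {a b c t} → a ≉ 0# → b ≉ 0# → a * t + b * (t * t) + c ≈ 0# →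
                  ∃ λ t′ → t′ ≉ t × a * t′ + b * (t′ * t′) + c ≈ 0#
    second-root {a} {b} {c} {t} a≉0 b≉0 root with inverse b b≉0
    ... | b⁻¹ , bb⁻¹≈1 = t + d , t+d≉t , (begin
      a * (t + d) + b * ((t + d) * (t + d)) + c
        ≈⟨ solve 5 (λ a b c t d →
             a :* (t :+ d) :+ b :* ((t :+ d) :* (t :+ d)) :+ c :=
             (a :* t :+ b :* (t :* t) :+ c) :+ (d :* (a :+ b :* d) :+ b :* (t :* d :+ t :* d)))
             refl a b c t d ⟩
      (a * t + b * (t * t) + c) + (d * (a + b * d) + b * (t * d + t * d))
        ≈⟨ +-cong root (+-cong (*-congˡ a+bd≈0) (*-congˡ (x+x≈0 (t * d)))) ⟩
      0# + (d * 0# + b * 0#)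
        ≈⟨ trans (+-identityˡ _) (trans (+-cong (zeroʳ d) (zeroʳ b)) (+-identityˡ 0#)) ⟩
      0# ∎)
      where
      d = a * b⁻¹

      bd≈a : b * d ≈ a
      bd≈a = x*[y*x⁻¹]≈y bb⁻¹≈1 a

      a+bd≈0 : a + b * d ≈ 0#
      a+bd≈0 = trans (+-congˡ bd≈a) (x+x≈0 a)

      t+d≉t : t + d ≉ t
      t+d≉t t+d≈t = a≉0 (trans (sym bd≈a) (trans (*-congˡ d≈0) (zeroʳ b)))
        where d≈0 = identityʳ-unique t d t+d≈t

module TwoConics {c ℓ : Level} (F : CommutativeRing c ℓ) (fld : IsFieldCR F) {q : ℕ}
                 (ord : HasOrder F q) where
  open CommutativeRing F
  open IsFieldCR fld
  open FieldProperties F fld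
  open HasOrder ord
  open Enumeration F ord
  open ProjectivePlane F
  open import Relation.Binary.Reasoning.Setoid setoid
  open Algebra.Properties.CommutativeSemigroup +-commutativeSemigroup using (xy∙z≈xz∙y)
  open Algebra.Solver.Ring.NaturalCoefficients.Default commutativeSemiring

  module _ (1+1≈0 : 1# + 1# ≈ 0#) (α : Carrier) (α≉0 : α ≉ 0#) (α≉1 : α ≉ 1#) where
    open Characteristic2 _≟_ 1+1≈0

    square-surjective : ∀ y → ∃ λ t → t * t ≈ y
    square-surjective = injective⇒surjective (λ t → t * t) square-injective

    -- The conic x² = yz without (0:1:0), the conic αx² = yz without (0:0:1),
    -- and their common nucleus.
    A : Carrier → Triple
    A t = t , t * t , 1#

    B : Carrier → Triple
    B u = u , α , u * u

    N : Triple
    N = 1# , 0# , 0#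

    As Bs points : List Triple
    As = tabulate (λ i → A (enum i))
    Bs = tabulate (λ i → B (enum i))
    points = As ++ Bs ++ [ N ]

    A∈points : ∀ i → A (enum i) ∈ points
    A∈points i = ∈-++⁺ˡ (∈-tabulate⁺ i)

    B∈points : ∀ i → B (enum i) ∈ points
    B∈points i = ∈-++⁺ʳ As (∈-++⁺ˡ (∈-tabulate⁺ i))

    N∈points : N ∈ points
    N∈points = ∈-++⁺ʳ As (∈-++⁺ʳ Bs (here ≡.refl))

    data Point : Triple → Set c where
      A-point : ∀ i → Point (A (enum i))
      B-point : ∀ i → Point (B (enum i))
      N-point : Point N

    ∈points⇒Point : ∀ {P} → P ∈ points → Point P
    ∈points⇒Point P∈ with ∈-++⁻ As P∈
    ... | inj₁ P∈As with ∈-tabulate⁻ P∈As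
    ...   | i , ≡.refl = A-point i
    ∈points⇒Point P∈ | inj₂ P∈BsN with ∈-++⁻ Bs P∈BsN
    ... | inj₁ P∈Bs with ∈-tabulate⁻ P∈Bs
    ...   | i , ≡.refl = B-point i
    ∈points⇒Point P∈ | inj₂ _ | inj₂ (here ≡.refl) = N-point

    nonzero-points : ∀ {P} → P ∈ points → Nonzero P
    nonzero-points P∈ with ∈points⇒Point P∈
    ... | A-point _ = λ (_ , _ , 1≈0) → 1≉0 1≈0
    ... | B-point _ = λ (_ , α≈0 , _) → α≉0 α≈0
    ... | N-point   = λ (1≈0 , _ , _) → 1≉0 1≈0

    A-injective : ∀ {t s} → Proportional (A t) (A s) → t ≈ s
    A-injective {t} {s} (l , _ , t≈ls , _ , 1≈l1) =
      trans t≈ls (trans (*-congʳ (x≈l*x⇒l≈1 1≉0 1≈l1)) (*-identityˡ s))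

    B-injective : ∀ {u v} → Proportional (B u) (B v) → u ≈ v
    B-injective {u} {v} (l , _ , u≈lv , α≈lα , _) =
      trans u≈lv (trans (*-congʳ (x≈l*x⇒l≈1 α≉0 α≈lα)) (*-identityˡ v))

    A≁B : ∀ {t u} → ¬ Proportional (A t) (B u)
    A≁B {t} {u} (l , l≉0 , t≈lu , t²≈lα , 1≈lu²) = α≉1 (*-cancelˡ l≉0 (begin
      l * α               ≈⟨ t²≈lα ⟨
      t * t               ≈⟨ *-cong t≈lu t≈lu ⟩
      (l * u) * (l * u)   ≈⟨ solve 2 (λ l u → (l :* u) :* (l :* u) := l :* (l :* (u :* u))) refl l u ⟩
      l * (l * (u * u))   ≈⟨ *-congˡ 1≈lu² ⟨
      l * 1#              ∎))

    B≁A₀ : ∀ {u s} → s ≈ 0# → ¬ Proportional (B u) (A s)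
    B≁A₀ s≈0 (l , _ , _ , α≈ls² , _) = α≉0 (trans α≈ls² (y≈0⇒x*y≈0 (y≈0⇒x*y≈0 s≈0)))

    A≁N : ∀ {t} → ¬ Proportional (A t) N
    A≁N (l , _ , _ , _ , 1≈l0) = 1≉0 (trans 1≈l0 (zeroʳ l))

    B≁N : ∀ {u} → ¬ Proportional (B u) N
    B≁N (l , _ , _ , α≈l0 , _) = α≉0 (trans α≈l0 (zeroʳ l))

    N≁A : ∀ {t} → ¬ Proportional N (A t)
    N≁A (l , l≉0 , _ , _ , 0≈l1) = l≉0 (sym (trans 0≈l1 (*-identityʳ l)))

    N≁B₀ : ∀ {s} → s ≈ 0# → ¬ Proportional N (B s)
    N≁B₀ s≈0 (l , _ , 1≈ls , _) = 1≉0 (trans 1≈ls (y≈0⇒x*y≈0 s≈0))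

    distinct-points : AllPairs (λ P P′ → ¬ Proportional P P′) points
    distinct-points =
      AllPairs.++⁺ As-distinct (AllPairs.++⁺ Bs-distinct ([] ∷ []) Bs≁N) As≁BsN
      where
      As-distinct : AllPairs (λ P P′ → ¬ Proportional P P′) As
      As-distinct = AllPairs.tabulate⁺ (λ i≢j AiAj → i≢j (enum-inj _ _ (A-injective AiAj)))

      Bs-distinct : AllPairs (λ P P′ → ¬ Proportional P P′) Bs
      Bs-distinct = AllPairs.tabulate⁺ (λ i≢j BiBj → i≢j (enum-inj _ _ (B-injective BiBj)))

      Bs≁N : All (λ P → All (λ P′ → ¬ Proportional P P′) [ N ]) Bs
      Bs≁N = All.tabulate⁺ (λ _ → B≁N ∷ [])

      As≁BsN : All (λ P → All (λ P′ → ¬ Proportional P P′) (Bs ++ [ N ])) As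
      As≁BsN = All.tabulate⁺ (λ _ → All.++⁺ (All.tabulate⁺ (λ _ → A≁B)) (A≁N ∷ []))

    S : PointSet
    S = record { pts = points ; nonzero = nonzero-points ; distinct = distinct-points }

    size-S : size S ≡ 2 ℕ.* q ℕ.+ 1
    size-S = length-tabulate-++-tabulate-++-[ N ] (λ i → A (enum i)) (λ i → B (enum i))

    MeetsAgain : Triple → Triple → Set (c ⊔ ℓ)
    MeetsAgain P L = ∃ λ P′ → P′ ∈ points × Incident P′ L × ¬ Proportional P P′

    A-incident-cong : ∀ {s t} L → s ≈ t → Incident (A t) L → Incident (A s) L
    A-incident-cong L s≈t =
      trans (+-congʳ (+-cong (*-congˡ s≈t) (*-congˡ (*-cong s≈t s≈t))))

    B-incident-cong : ∀ {s u} L → s ≈ u → Incident (B u) L → Incident (B s) L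
    B-incident-cong L s≈u =
      trans (+-cong (+-congʳ (*-congˡ s≈u)) (*-congˡ (*-cong s≈u s≈u)))

    -- The witness is the listed representative A (enum (index t)) of A t.
    meets-A : ∀ {P} L t → Incident (A t) L → (∀ {s} → s ≈ t → ¬ Proportional P (A s)) →
              MeetsAgain P L
    meets-A L t on P≁ = A (enum (index t)) , A∈points (index t) ,
                        A-incident-cong L (enum-index t) on , P≁ (enum-index t)

    meets-B : ∀ {P} L u → Incident (B u) L → (∀ {s} → s ≈ u → ¬ Proportional P (B s)) →
              MeetsAgain P L
    meets-B L u on P≁ = B (enum (index u)) , B∈points (index u) ,
                        B-incident-cong L (enum-index u) on , P≁ (enum-index u)

    meets-N : ∀ {P} L → Incident N L → ¬ Proportional P N → MeetsAgain P L
    meets-N L on P≁N = N , N∈points , on , P≁N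

    N-incident : ∀ {a b c′} → a ≈ 0# → Incident N (a , b , c′)
    N-incident a≈0 = x+y+z≈0 (x≈0⇒x*y≈0 a≈0) (zeroʳ _) (zeroʳ _)

    N-incident⁻¹ : ∀ {a b c′} → Incident N (a , b , c′) → a ≈ 0#
    N-incident⁻¹ {a} {b} {c′} on = begin
      a                          ≈⟨ *-identityʳ a ⟨
      a * 1#                     ≈⟨ +-identityʳ _ ⟨
      a * 1# + 0#                ≈⟨ +-identityʳ _ ⟨
      a * 1# + 0# + 0#           ≈⟨ +-cong (+-congˡ (zeroʳ b)) (zeroʳ c′) ⟨
      a * 1# + b * 0# + c′ * 0#  ≈⟨ on ⟩
      0#                         ∎

    A₀-incident : ∀ {a b c′} → c′ ≈ 0# → Incident (A 0#) (a , b , c′)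
    A₀-incident c′≈0 = x+y+z≈0 (zeroʳ _) (y≈0⇒x*y≈0 (zeroʳ 0#)) (x≈0⇒x*y≈0 c′≈0)

    B₀-incident : ∀ {a b c′} → b ≈ 0# → Incident (B 0#) (a , b , c′)
    B₀-incident b≈0 = x+y+z≈0 (zeroʳ _) (x≈0⇒x*y≈0 b≈0) (y≈0⇒x*y≈0 (zeroʳ 0#))

    meets-again-A : ∀ t L → Incident (A t) L → MeetsAgain (A t) L
    meets-again-A t L@(a , b , c′) on with a ≟ 0# | b ≟ 0#
    ... | yes a≈0 | _       = meets-N L (N-incident a≈0) A≁N
    ... | no  _   | yes b≈0 = meets-B L 0# (B₀-incident b≈0) (λ _ → A≁B)
    ... | no  a≉0 | no  b≉0 with t′ , t′≉t , on′ ← second-root a≉0 b≉0 on =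
      meets-A L t′ on′ (λ s≈t′ AtAs → t′≉t (trans (sym s≈t′) (sym (A-injective AtAs))))

    meets-again-B : ∀ u L → Incident (B u) L → MeetsAgain (B u) L
    meets-again-B u L@(a , b , c′) on with a ≟ 0# | c′ ≟ 0#
    ... | yes a≈0 | _        = meets-N L (N-incident a≈0) B≁N
    ... | no  _   | yes c′≈0 = meets-A L 0# (A₀-incident c′≈0) B≁A₀
    ... | no  a≉0 | no  c′≉0
      with u′ , u′≉u , on′ ← second-root a≉0 c′≉0 (trans (xy∙z≈xz∙y _ _ _) on) =
      meets-B L u′ (trans (xy∙z≈xz∙y _ _ _) on′)
        (λ s≈u′ BuBs → u′≉u (trans (sym s≈u′) (sym (B-injective BuBs))))

    meets-again-N : ∀ L → Incident N L → MeetsAgain N L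
    meets-again-N L@(a , b , c′) on with b ≟ 0#
    ... | yes b≈0 = meets-B L 0# (B₀-incident b≈0) N≁B₀
    ... | no  b≉0 with b⁻¹ , bb⁻¹≈1 ← inverse b b≉0
                  with t , t²≈c′b⁻¹ ← square-surjective (c′ * b⁻¹) =
      meets-A L t (begin
        a * t + b * (t * t) + c′ * 1#
          ≈⟨ +-cong (+-cong (x≈0⇒x*y≈0 (N-incident⁻¹ on)) (*-congˡ t²≈c′b⁻¹)) (*-identityʳ c′) ⟩
        0# + b * (c′ * b⁻¹) + c′
          ≈⟨ +-congʳ (trans (+-identityˡ _) (x*[y*x⁻¹]≈y bb⁻¹≈1 c′)) ⟩
        c′ + c′
          ≈⟨ x+x≈0 c′ ⟩
        0# ∎) (λ _ → N≁A)

    untouchable : Untouchable S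
    untouchable L _ P∈ on with ∈points⇒Point P∈
    ... | A-point i = meets-again-A (enum i) L on
    ... | B-point i = meets-again-B (enum i) L on
    ... | N-point   = meets-again-N L on

    untouchable-set : Σ PointSet λ S → (size S ≡ 2 ℕ.* q ℕ.+ 1) × Untouchable S
    untouchable-set = S , size-S , untouchable

3≤k⇒3≤2^k : ∀ {k} → 3 ≤ k → 3 ≤ 2 ℕ.^ k
3≤k⇒3≤2^k 3≤k = ℕP.≤-trans (s≤s (s≤s (s≤s z≤n))) (ℕP.^-monoʳ-≤ 2 3≤k)

open import Data.Nat using (_+_; _*_; _^_)

mainTheorem3 : ∀ {c ℓ : Level} (k : ℕ) → 3 ≤ k →
    (F : CommutativeRing c ℓ) → IsFieldCR F → HasOrder F (2 ^ k) →
    let open ProjectivePlane F in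
    Σ PointSet λ S → (size S ≡ 2 * (2 ^ k) + 1) × Untouchable S
mainTheorem3 k 3≤k F fld ord
  with α , α≉0 , α≉1 ← Enumeration.∃≉0,1 F ord (3≤k⇒3≤2^k 3≤k) =
  TwoConics.untouchable-set F fld ord (FieldProperties.order-2^k⇒1+1≈0 F fld k ord) α α≉0 α≉1
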